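{- For every $k\in\mathbb{N}$ there is a constant $C$ such that $|\mathcal{L}^k_n|\le n!\,C^n$ for all $n\in\mathbb{N}$.
   Context: Two distinct letters $\mathtt a,\mathtt b$ alternate in a word $w$ if deleting all other letters yields one of $(\mathtt{ab})^n$, $(\mathtt{ab})^n\mathtt a$, $(\mathtt{ba})^n$, $(\mathtt{ba})^n\mathtt b$ for some $n\ge1$. A graph $G=(V,E)$ is represented by $w$ if the set of letters of $w$ is $V$ and distinct $\mathtt a,\mathtt b\in V$ alternate in $w$ iff $\{\mathtt a,\mathtt b\}\in E$. A marking sequence for $w$ is an enumeration $(\mathtt a_1,\dots,\mathtt a_n)$ of the distinct letters of $w$; at stage $i$ all occurrences of $\mathtt a_1,\dots,\mathtt a_i$ are marked, and a marked block is a maximal factor of consecutive marked positions; $w$ is $k$-local if some marking sequence gives at most $k$ marked blocks at every stage. $\mathcal L^k$ is the class of graphs represented by some $k$-local word, and $\mathcal L^k_n=\{G\in\mathcal L^k\mid V(G)=\{1,\dots,n\}\}$. -}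

module Defs where

open import Data.Nat using (ℕ; zero; suc; _≤_)
open import Data.Bool using (Bool; true; false; if_then_else_)
open import Data.Fin using (Fin)
open import Data.Fin.Properties using (_≟_)
open import Data.List using (List; []; _∷_; _++_; [_]; concat; replicate; filter; take; length)
open import Data.Bool.ListAction using (any)
open import Data.List.Membership.Propositional using (_∈_)
open import Data.List.Relation.Unary.Unique.Propositional using (Unique)
open import Data.Vec using (Vec; lookup)
open import Data.Product using (_×_; ∃-syntax)
open import Data.Sum using (_⊎_)
open import Relation.Nullary using (¬_; does)
open import Relation.Nullary.Decidable using (_⊎-dec_)
open import Relation.Binary.PropositionalEquality using (_≡_; _≢_)
open import Function.Bundles using (_⇔_)

-- A labelled graph on vertex set Fin n (playing the role of {1,…,n}),
-- given by its adjacency matrix.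
Graph : ℕ → Set
Graph n = Vec (Vec Bool n) n

adj : ∀ {n} → Graph n → Fin n → Fin n → Bool
adj G a b = lookup (lookup G a) b

IsSimple : ∀ {n} → Graph n → Set
IsSimple {n} G = (∀ a b → adj G a b ≡ adj G b a) × (∀ a → adj G a a ≡ false)

Word : ℕ → Set
Word n = List (Fin n)

restrict : ∀ {n} → Fin n → Fin n → Word n → Word n
restrict a b w = filter (λ x → (x ≟ a) ⊎-dec (x ≟ b)) w

_^^_ : ∀ {n} → Word n → ℕ → Word n
u ^^ m = concat (replicate m u)

Alternate : ∀ {n} → Fin n → Fin n → Word n → Set
Alternate a b w =
  ∃[ m ] (1 ≤ m × ( restrict a b w ≡ ((a ∷ b ∷ []) ^^ m)
                  ⊎ restrict a b w ≡ ((a ∷ b ∷ []) ^^ m) ++ [ a ]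
                  ⊎ restrict a b w ≡ ((b ∷ a ∷ []) ^^ m)
                  ⊎ restrict a b w ≡ ((b ∷ a ∷ []) ^^ m) ++ [ b ]))

Represents : ∀ {n} → Graph n → Word n → Set
Represents {n} G w =
  (∀ (v : Fin n) → v ∈ w) ×
  (∀ a b → a ≢ b → (Alternate a b w ⇔ (adj G a b ≡ true)))

marked : ∀ {n} → List (Fin n) → Fin n → Bool
marked ms x = any (λ y → does (x ≟ y)) ms

blocksFrom : ∀ {n} → (Fin n → Bool) → Bool → Word n → ℕ
blocksFrom m prev [] = 0
blocksFrom m prev (x ∷ w) =
  if m x then (if prev then blocksFrom m true w else suc (blocksFrom m true w))
         else blocksFrom m false w

blocks : ∀ {n} → (Fin n → Bool) → Word n → ℕ
blocks m w = blocksFrom m false w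

IsMarkingSequence : ∀ {n} → Word n → List (Fin n) → Set
IsMarkingSequence w σ = Unique σ × (∀ x → (x ∈ σ ⇔ x ∈ w))

KLocal : ∀ {n} → ℕ → Word n → Set
KLocal k w = ∃[ σ ] (IsMarkingSequence w σ ×
  (∀ i → i ≤ length σ → blocks (marked (take i σ)) w ≤ k))

InL : (k n : ℕ) → Graph n → Set
InL k n G = IsSimple G × ∃[ w ] (Represents G w × KLocal k w)

-- Strip the isolated vertices from a k-local word w representing G.  The resulting word w′ still
-- represents G up to isolated vertices and is still k-local, and since each of its letters
-- alternates with a neighbour, no letter occurs twice in a row.  Follow the marking sequence and
-- record, after each stage, the skeleton of w′: the marked letters, with every maximal unmarked
-- factor collapsed to a single gap.  Marking the next letter a turns each of the at most k + 1 gaps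
-- into a pattern of a's and gaps; as a never repeats and the new stage also has at most k blocks,
-- each pattern has length at most 2k + 1.  So w′, and with it G, is determined by the marking order
-- (n! choices, written as a Lehmer code) together with n pattern lists drawn from a finite alphabet
-- depending only on k.

module Submission where

open import Defs
open import Data.Nat using (ℕ; _≤_; _*_; _^_; _!)
open import Data.List using (List; length)
open import Data.List.Relation.Unary.All using (All)
open import Data.List.Relation.Unary.Unique.Propositional using (Unique)
open import Data.Product using (∃-syntax)

open import Data.Bool using (Bool; true; false; not; _∨_; if_then_else_)
open import Data.Bool.Properties using (∨-zeroʳ; ⇔→≡) renaming (_≟_ to _≟ᵇ_)
open import Data.Empty using (⊥; ⊥-elim)
open import Data.Fin using (Fin)
open import Data.Fin.Properties using (_≟_; any?)
open import Data.List using ([]; _∷_; _++_; [_]; map; filter; take; concatMap; upTo; allFin)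
open import Data.List.Properties
  using (length-map; length-++; length-upTo; length-tabulate; ++-assoc; ++-identityʳ;
         filter-++; filter-accept; filter-reject; map-injective; ∷-injectiveʳ)
open import Data.List.Membership.Propositional using (_∈_; _∉_; lose)
open import Data.List.Membership.Propositional.Properties
  using (∈-map⁺; ∈-++⁺ˡ; ∈-++⁺ʳ; ∈-++⁻; ∈-concatMap⁺; ∈-upTo⁺; ∈-allFin;
         ∈-filter⁺; ∈-filter⁻)
open import Data.List.Relation.Binary.Subset.Propositional using (_⊆_)
open import Data.List.Relation.Unary.Any using (here; there)
import Data.List.Relation.Unary.All as All
open import Data.List.Relation.Unary.All using ([]; _∷_)
open import Data.List.Relation.Unary.AllPairs using (_∷_)
open import Data.List.Relation.Unary.Linked as Linked using (Linked; []; [-]; _∷_)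
open import Data.Maybe using (Maybe; just; nothing; is-just)
import Data.Maybe as Maybe
open import Data.Maybe.Properties using (just-injective)
import Data.Maybe.Relation.Unary.All as MaybeAll
open import Data.Nat using (zero; suc; _+_; _<_; z≤n; s≤s)
open import Data.Nat.Properties
  using (≤-refl; ≤-trans; ≤-reflexive; n≤1+n; m≤n+m; m≤m+n; +-suc; +-mono-≤; +-monoʳ-≤;
         module ≤-Reasoning)
open import Data.Nat.Tactic.RingSolver using (solve-∀)
open import Data.Product using (_×_; _,_; proj₁; proj₂; map₂)
open import Data.Sum using (_⊎_; inj₁; inj₂)
import Data.Sum as Sum
open import Data.Vec using (lookup; tabulate)
open import Data.Vec.Properties using (tabulate∘lookup; tabulate-cong)
open import Function using (id; _∘_; _⇔_; mk⇔; Equivalence)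
open import Function.Properties.Equivalence using () renaming (sym to ⇔-sym; trans to ⇔-trans)
open import Relation.Nullary using (¬_; yes; no; does; contradiction)
open import Relation.Nullary.Decidable using (_⊎-dec_; dec-true)
open import Relation.Unary using (Decidable)
open import Relation.Binary.PropositionalEquality
  using (_≡_; _≢_; refl; sym; trans; cong; cong₂; subst; module ≡-Reasoning)

pick : {A : Set} → List A → ℕ → Maybe (A × List A)
pick []       _       = nothing
pick (x ∷ xs) zero    = just (x , xs)
pick (x ∷ xs) (suc j) = Maybe.map (map₂ (x ∷_)) (pick xs j)

record Picking {A : Set} (xs : List A) (x : A) : Set where
  field
    index            : ℕ
    remainder        : List A
    pick-index       : pick xs index ≡ just (x , remainder)
    index<length     : index < length xs
    length-remainder : length xs ≡ suc (length remainder)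
    ∈-remainder      : ∀ {y} → y ∈ xs → y ≢ x → y ∈ remainder

picking : {A : Set} {xs : List A} {x : A} → x ∈ xs → Picking xs x
picking {xs = x ∷ xs} (here refl) = record
  { index            = zero
  ; remainder        = xs
  ; pick-index       = refl
  ; index<length     = s≤s z≤n
  ; length-remainder = refl
  ; ∈-remainder      = λ { (here refl) y≢y → ⊥-elim (y≢y refl) ; (there y∈xs) _ → y∈xs }
  }
picking {xs = z ∷ xs} (there x∈xs) = record
  { index            = suc index
  ; remainder        = z ∷ remainder
  ; pick-index       = cong (Maybe.map (map₂ (z ∷_))) pick-index
  ; index<length     = s≤s index<length
  ; length-remainder = cong suc length-remainder
  ; ∈-remainder      = λ { (here refl) _ → here refl
                         ; (there y∈xs) y≢x → there (∈-remainder y∈xs y≢x) }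
  }
  where open Picking (picking x∈xs)

length-≤-injectiveRel : {A B : Set} (R : A → B → Set) {xs : List A} {ys : List B} →
  Unique xs → (∀ {x} → x ∈ xs → ∃[ y ] (y ∈ ys × R x y)) →
  (∀ {x x′ y} → R x y → R x′ y → x ≡ x′) → length xs ≤ length ys
length-≤-injectiveRel R {[]} _ _ _ = z≤n
length-≤-injectiveRel R {x ∷ xs} (x∉xs ∷ unique) image injective with image (here refl)
... | y , y∈ys , Rxy =
  ≤-trans (s≤s (length-≤-injectiveRel R unique image′ injective))
          (≤-reflexive (sym length-remainder))
  where
  open Picking (picking y∈ys)
  image′ : ∀ {x′} → x′ ∈ xs → ∃[ y′ ] (y′ ∈ remainder × R x′ y′)
  image′ x′∈xs with image (there x′∈xs)
  ... | y′ , y′∈ys , Rx′y′ =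
    y′ , ∈-remainder y′∈ys (λ { refl → All.lookup x∉xs x′∈xs (injective Rxy Rx′y′) }) ,
    Rx′y′

listsUpTo : {A : Set} → ℕ → List A → List (List A)
listsUpTo zero    xs = [ [] ]
listsUpTo (suc L) xs = [] ∷ concatMap (λ x → map (x ∷_) (listsUpTo L xs)) xs

∈-listsUpTo : {A : Set} (L : ℕ) {xs ys : List A} →
  length ys ≤ L → ys ⊆ xs → ys ∈ listsUpTo L xs
∈-listsUpTo zero    {ys = []}     _         _     = here refl
∈-listsUpTo (suc L) {ys = []}     _         _     = here refl
∈-listsUpTo (suc L) {ys = y ∷ ys} (s≤s ys≤L) ys⊆xs =
  there (∈-concatMap⁺ _ (lose (ys⊆xs (here refl))
    (∈-map⁺ (y ∷_) (∈-listsUpTo L ys≤L (ys⊆xs ∘ there)))))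

length-concatMap-const : {A B : Set} (f : A → List B) {c : ℕ} → (∀ x → length (f x) ≡ c) →
  ∀ xs → length (concatMap f xs) ≡ length xs * c
length-concatMap-const f fc []       = refl
length-concatMap-const f fc (x ∷ xs) =
  trans (length-++ (f x)) (cong₂ _+_ (fc x) (length-concatMap-const f fc xs))

-- An entry (j , b) of a code picks, by its position j, one of the letters not yet picked.
lehmerCodes : {B : Set} → List B → ℕ → List (List (ℕ × B))
lehmerCodes bs zero    = [ [] ]
lehmerCodes bs (suc r) =
  concatMap (λ j → concatMap (λ b → map ((j , b) ∷_) (lehmerCodes bs r)) bs) (upTo (suc r))

length-lehmerCodes : {B : Set} (bs : List B) (r : ℕ) →
  length (lehmerCodes bs r) ≡ r ! * length bs ^ r
length-lehmerCodes bs zero    = refl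
length-lehmerCodes {B} bs (suc r) = begin
  length (lehmerCodes bs (suc r))
    ≡⟨ length-concatMap-const (λ j → concatMap (extend j) bs)
         (λ j → length-concatMap-const (extend j) (λ b → length-extend j b) bs) (upTo (suc r)) ⟩
  length (upTo (suc r)) * (length bs * (r ! * length bs ^ r))
    ≡⟨ cong (_* (length bs * (r ! * length bs ^ r))) (length-upTo (suc r)) ⟩
  suc r * (length bs * (r ! * length bs ^ r))
    ≡⟨ rearrange (suc r) (length bs) (r !) (length bs ^ r) ⟩
  suc r ! * length bs ^ suc r ∎
  where
  open ≡-Reasoning
  extend : ℕ → B → List (List (ℕ × B))
  extend j b = map ((j , b) ∷_) (lehmerCodes bs r)
  length-extend : ∀ j b → length (extend j b) ≡ r ! * length bs ^ r
  length-extend j b = trans (length-map _ (lehmerCodes bs r)) (length-lehmerCodes bs r)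
  rearrange : ∀ a b c d → a * (b * (c * d)) ≡ a * c * (b * d)
  rearrange = solve-∀

data IsLehmerCode {B : Set} (bs : List B) : ℕ → List (ℕ × B) → Set where
  []   : IsLehmerCode bs zero []
  cons : ∀ {r j b c} → j < suc r → b ∈ bs → IsLehmerCode bs r c →
         IsLehmerCode bs (suc r) ((j , b) ∷ c)

∈-lehmerCodes : {B : Set} {bs : List B} {r : ℕ} {c : List (ℕ × B)} →
  IsLehmerCode bs r c → c ∈ lehmerCodes bs r
∈-lehmerCodes []                                = here refl
∈-lehmerCodes (cons {j = j} {b} j≤r b∈bs code) =
  ∈-concatMap⁺ _ (lose (∈-upTo⁺ j≤r)
    (∈-concatMap⁺ _ (lose b∈bs (∈-map⁺ ((j , b) ∷_) (∈-lehmerCodes code)))))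

module _ {n : ℕ} (m : Fin n → Bool) where

  blocksFrom-true≤false : ∀ w → blocksFrom m true w ≤ blocksFrom m false w
  blocksFrom-true≤false []      = z≤n
  blocksFrom-true≤false (y ∷ w) with m y
  ... | true  = n≤1+n _
  ... | false = ≤-refl

  blocksFrom-false≤suc-true : ∀ w → blocksFrom m false w ≤ suc (blocksFrom m true w)
  blocksFrom-false≤suc-true []      = z≤n
  blocksFrom-false≤suc-true (y ∷ w) with m y
  ... | true  = ≤-refl
  ... | false = n≤1+n _

  blocksFrom≤blocks : ∀ p w → blocksFrom m p w ≤ blocks m w
  blocksFrom≤blocks true  w = blocksFrom-true≤false w
  blocksFrom≤blocks false w = ≤-refl

  blocks-∷ : ∀ y w → blocks m w ≤ blocks m (y ∷ w)
  blocks-∷ y w with m y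
  ... | true  = blocksFrom-false≤suc-true w
  ... | false = ≤-refl

  blocksFrom-∷-mono : ∀ u v → (∀ q → blocksFrom m q u ≤ blocksFrom m q v) →
    ∀ p y → blocksFrom m p (y ∷ u) ≤ blocksFrom m p (y ∷ v)
  blocksFrom-∷-mono _ _ u≤v p y with m y | p
  ... | true  | true  = u≤v true
  ... | true  | false = s≤s (u≤v true)
  ... | false | _     = u≤v false

  blocksFrom-filter : {P : Fin n → Set} (P? : Decidable P) →
    ∀ p w → blocksFrom m p (filter P? w) ≤ blocksFrom m p w
  blocksFrom-filter P? p []      = z≤n
  blocksFrom-filter P? p (y ∷ w) with does (P? y)
  ... | true  = blocksFrom-∷-mono (filter P? w) w (λ q → blocksFrom-filter P? q w) p y
  ... | false with m y | p
  ...   | true  | true  = blocksFrom-filter P? true w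
  ...   | true  | false =
    ≤-trans (blocksFrom-false≤suc-true (filter P? w)) (s≤s (blocksFrom-filter P? true w))
  ...   | false | p     =
    ≤-trans (blocksFrom≤blocks p (filter P? w)) (blocksFrom-filter P? false w)

Skeleton : ℕ → Set
Skeleton n = List (Maybe (Fin n))

Pattern : Set
Pattern = List Bool

NotBothMarked : {n : ℕ} → (Fin n → Bool) → Fin n → Fin n → Set
NotBothMarked m x y = m x ≡ true → m y ≡ true → ⊥

module _ {n : ℕ} where

  emit : (Fin n → Bool) → Bool → Fin n → Skeleton n
  emit m inGap x = if m x then [ just x ] else if inGap then [] else [ nothing ]

  skeletonFrom : (Fin n → Bool) → Bool → Word n → Skeleton n
  skeletonFrom m inGap []      = []
  skeletonFrom m inGap (x ∷ w) = emit m inGap x ++ skeletonFrom m (not (m x)) w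

  -- The leading gap stands for the possibly empty unmarked prefix, so that with nothing marked
  -- every word has the skeleton [ nothing ].
  skeleton : (Fin n → Bool) → Word n → Skeleton n
  skeleton m w = nothing ∷ skeletonFrom m true w

  shape : Skeleton n → Pattern
  shape = map is-just

  instantiate : Fin n → Pattern → Skeleton n
  instantiate a = map (λ b → if b then just a else nothing)

  refine : Fin n → List Pattern → Skeleton n → Skeleton n
  refine a ps       []            = []
  refine a ps       (just x ∷ S)  = just x ∷ refine a ps S
  refine a []       (nothing ∷ S) = nothing ∷ refine a [] S
  refine a (p ∷ ps) (nothing ∷ S) = instantiate a p ++ refine a ps S

  refine-[] : ∀ a S → refine a [] S ≡ S
  refine-[] a []            = refl
  refine-[] a (just x ∷ S)  = cong (just x ∷_) (refine-[] a S)
  refine-[] a (nothing ∷ S) = cong (nothing ∷_) (refine-[] a S)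

  instantiate-shape : ∀ {a} {S : Skeleton n} → All (MaybeAll.All (_≡ a)) S →
    instantiate a (shape S) ≡ S
  instantiate-shape []                         = refl
  instantiate-shape (MaybeAll.just refl ∷ S≡a) = cong (just _ ∷_) (instantiate-shape S≡a)
  instantiate-shape (MaybeAll.nothing ∷ S≡a)   = cong (nothing ∷_) (instantiate-shape S≡a)

  skeletonFrom-letters : ∀ {m : Fin n → Bool} {a} g {w} → All (λ y → m y ≡ true → y ≡ a) w →
    All (MaybeAll.All (_≡ a)) (skeletonFrom m g w)
  skeletonFrom-letters     g {[]}    []          = []
  skeletonFrom-letters {m} g {y ∷ w} (y≡a ∷ w≡a) with m y in my | g
  ... | true  | _     = MaybeAll.just (y≡a refl) ∷ skeletonFrom-letters false w≡a
  ... | false | true  = skeletonFrom-letters true w≡a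
  ... | false | false = MaybeAll.nothing ∷ skeletonFrom-letters true w≡a

  skeletonFrom-allMarked : ∀ {m : Fin n → Bool} g {w} → (∀ {y} → y ∈ w → m y ≡ true) →
    skeletonFrom m g w ≡ map just w
  skeletonFrom-allMarked     g {[]}    _        = refl
  skeletonFrom-allMarked {m} g {y ∷ w} w-marked with m y | w-marked (here refl)
  ... | true | refl = cong (just y ∷_) (skeletonFrom-allMarked false (w-marked ∘ there))

  skeletonFrom-noneMarked : ∀ w → skeletonFrom (marked []) true w ≡ []
  skeletonFrom-noneMarked []      = refl
  skeletonFrom-noneMarked (y ∷ w) = skeletonFrom-noneMarked w

  blocksFrom-afterMarked : ∀ {m : Fin n → Bool} {y} w → m y ≡ true →
    Linked (NotBothMarked m) (y ∷ w) → blocksFrom m true w ≡ blocksFrom m false w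
  blocksFrom-afterMarked     []      _  _             = refl
  blocksFrom-afterMarked {m} (z ∷ w) my (notBoth ∷ _) with m z
  ... | true  = ⊥-elim (notBoth my refl)
  ... | false = refl

  length-skeletonFrom : ∀ {m : Fin n → Bool} g {w} → Linked (NotBothMarked m) w →
    length (skeletonFrom m g w) ≤ (if g then 0 else 1) + (blocks m w + blocks m w)
  length-skeletonFrom     g {[]}    _      = z≤n
  length-skeletonFrom {m} g {y ∷ w} linked with m y in my | g
  ... | false | true  = length-skeletonFrom true (Linked.tail linked)
  ... | false | false = s≤s (length-skeletonFrom true (Linked.tail linked))
  ... | true  | g     = begin
    suc (length (skeletonFrom m false w))
      ≤⟨ s≤s (length-skeletonFrom false (Linked.tail linked)) ⟩
    suc (suc (B + B))
      ≡⟨ cong suc (sym (+-suc B B)) ⟩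
    suc B + suc B
      ≡⟨ cong (λ B″ → suc B″ + suc B″) (sym (blocksFrom-afterMarked w my linked)) ⟩
    suc B′ + suc B′
      ≤⟨ m≤n+m _ (if g then 0 else 1) ⟩
    (if g then 0 else 1) + (suc B′ + suc B′) ∎
    where
    open ≤-Reasoning
    B  = blocks m w
    B′ = blocksFrom m true w

  module Refinement (m m′ : Fin n → Bool) (a : Fin n)
    (stays-marked : ∀ y → m y ≡ true → m′ y ≡ true)
    (newly-marked : ∀ y → m y ≡ false → m′ y ≡ true → y ≡ a) where

    unmarkedPrefix : Word n → Word n
    unmarkedPrefix []      = []
    unmarkedPrefix (y ∷ w) = if m y then [] else y ∷ unmarkedPrefix w

    -- One pattern for each maximal m-unmarked factor, telling how marking a splits it; inGap
    -- means that the factor containing the current position has been accounted for already.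
    gapPatterns : Bool → Word n → List Pattern
    gapPatterns inGap []      = []
    gapPatterns inGap (y ∷ w) =
      if m y then gapPatterns false w
      else if inGap then gapPatterns true w
      else shape (skeletonFrom m′ false (y ∷ unmarkedPrefix w)) ∷ gapPatterns true w

    refinementPatterns : Word n → List Pattern
    refinementPatterns w = shape (skeleton m′ (unmarkedPrefix w)) ∷ gapPatterns true w

    unmarkedPrefix-letters : ∀ w → All (λ y → m′ y ≡ true → y ≡ a) (unmarkedPrefix w)
    unmarkedPrefix-letters []      = []
    unmarkedPrefix-letters (y ∷ w) with m y in my
    ... | true  = []
    ... | false = newly-marked y my ∷ unmarkedPrefix-letters w

    mutual
      skeletonFrom-refine : ∀ g w → skeletonFrom m′ g w ≡
        skeletonFrom m′ g (unmarkedPrefix w) ++ refine a (gapPatterns true w) (skeletonFrom m true w)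
      skeletonFrom-refine g []      = refl
      skeletonFrom-refine g (y ∷ w) with m y in my
      ... | false = skeletonFrom-refine-∷ g y w
      ... | true  with m′ y | stays-marked y my
      ...   | true | refl = cong (just y ∷_) (skeletonFrom-refine-outside w)

      skeletonFrom-refine-∷ : ∀ g y w → skeletonFrom m′ g (y ∷ w) ≡
        skeletonFrom m′ g (y ∷ unmarkedPrefix w) ++ refine a (gapPatterns true w) (skeletonFrom m true w)
      skeletonFrom-refine-∷ g y w =
        trans (cong (emit m′ g y ++_) (skeletonFrom-refine (not (m′ y)) w))
              (sym (++-assoc (emit m′ g y) _ _))

      skeletonFrom-refine-outside : ∀ w →
        skeletonFrom m′ false w ≡ refine a (gapPatterns false w) (skeletonFrom m false w)
      skeletonFrom-refine-outside []      = refl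
      skeletonFrom-refine-outside (y ∷ w) with m y in my
      ... | false = trans (skeletonFrom-refine-∷ false y w) (cong (_++ _) (sym (instantiate-shape
                      (skeletonFrom-letters false (newly-marked y my ∷ unmarkedPrefix-letters w)))))
      ... | true  with m′ y | stays-marked y my
      ...   | true | refl = cong (just y ∷_) (skeletonFrom-refine-outside w)

    skeleton-refine : ∀ w → skeleton m′ w ≡ refine a (refinementPatterns w) (skeleton m w)
    skeleton-refine w = begin
      nothing ∷ skeletonFrom m′ true w
        ≡⟨ cong (nothing ∷_) (skeletonFrom-refine true w) ⟩
      skeleton m′ (unmarkedPrefix w) ++ rest
        ≡⟨ cong (_++ rest) (sym (instantiate-shape
             (MaybeAll.nothing ∷ skeletonFrom-letters true (unmarkedPrefix-letters w)))) ⟩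
      instantiate a (shape (skeleton m′ (unmarkedPrefix w))) ++ rest ∎
      where
      open ≡-Reasoning
      rest = refine a (gapPatterns true w) (skeletonFrom m true w)

    length-gapPatterns : ∀ g w →
      length (gapPatterns g w) ≤ (if g then 0 else 1) + blocksFrom m (not g) w
    length-gapPatterns g []      = z≤n
    length-gapPatterns g (y ∷ w) with m y | g
    ... | true  | true  = length-gapPatterns false w
    ... | true  | false = length-gapPatterns false w
    ... | false | true  = length-gapPatterns true w
    ... | false | false = s≤s (length-gapPatterns true w)

    length-refinementPatterns : ∀ w → length (refinementPatterns w) ≤ suc (blocks m w)
    length-refinementPatterns w = s≤s (length-gapPatterns true w)

    blocksFrom-unmarkedPrefix : ∀ μ q w → blocksFrom μ q (unmarkedPrefix w) ≤ blocksFrom μ q w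
    blocksFrom-unmarkedPrefix μ q []      = z≤n
    blocksFrom-unmarkedPrefix μ q (y ∷ w) with m y
    ... | true  = z≤n
    ... | false =
      blocksFrom-∷-mono μ (unmarkedPrefix w) w (λ q′ → blocksFrom-unmarkedPrefix μ q′ w) q y

    run-notBothMarked : ∀ {y} w → m y ≡ false → Linked _≢_ (y ∷ w) →
      Linked (NotBothMarked m′) (y ∷ unmarkedPrefix w)
    run-notBothMarked []      _  _              = [-]
    run-notBothMarked (z ∷ w) my (y≢z ∷ linked) with m z in mz
    ... | true  = [-]
    ... | false =
      (λ m′y m′z → y≢z (trans (newly-marked _ my m′y) (sym (newly-marked z mz m′z))))
      ∷ run-notBothMarked w mz linked

    module _ {k : ℕ} where

      length-runSkeleton : ∀ g {y} w → m y ≡ false → Linked _≢_ (y ∷ w) →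
        blocks m′ (y ∷ w) ≤ k →
        length (skeletonFrom m′ g (y ∷ unmarkedPrefix w)) ≤ (if g then 0 else 1) + (k + k)
      length-runSkeleton g {y} w my linked B≤k =
        ≤-trans (length-skeletonFrom g (run-notBothMarked w my linked))
                (+-monoʳ-≤ (if g then 0 else 1) (+-mono-≤ B≤ B≤))
        where
        B≤ : blocks m′ (y ∷ unmarkedPrefix w) ≤ k
        B≤ = ≤-trans (blocksFrom-∷-mono m′ (unmarkedPrefix w) w
                        (λ q → blocksFrom-unmarkedPrefix m′ q w) false y)
                     B≤k

      length-prefixSkeleton : ∀ w → Linked _≢_ w → blocks m′ w ≤ k →
        length (skeletonFrom m′ true (unmarkedPrefix w)) ≤ k + k
      length-prefixSkeleton []      _      _   = z≤n
      length-prefixSkeleton (y ∷ w) linked B≤k with m y in my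
      ... | true  = z≤n
      ... | false = length-runSkeleton true w my linked B≤k

      gapPatterns-short : ∀ g w → Linked _≢_ w → blocks m′ w ≤ k →
        All (λ p → length p ≤ suc (k + k)) (gapPatterns g w)
      gapPatterns-short g []      _      _   = []
      gapPatterns-short g (y ∷ w) linked B≤k with m y in my | g
      ... | true  | _     = gapPatterns-short false w (Linked.tail linked) tail-B≤k
        where tail-B≤k = ≤-trans (blocks-∷ m′ y w) B≤k
      ... | false | true  = gapPatterns-short true w (Linked.tail linked) tail-B≤k
        where tail-B≤k = ≤-trans (blocks-∷ m′ y w) B≤k
      ... | false | false =
        ≤-trans (≤-reflexive (length-map is-just (skeletonFrom m′ false (y ∷ unmarkedPrefix w))))
                (length-runSkeleton false w my linked B≤k)
        ∷ gapPatterns-short true w (Linked.tail linked) tail-B≤k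
        where tail-B≤k = ≤-trans (blocks-∷ m′ y w) B≤k

      refinementPatterns-short : ∀ w → Linked _≢_ w → blocks m′ w ≤ k →
        All (λ p → length p ≤ suc (k + k)) (refinementPatterns w)
      refinementPatterns-short w linked B≤k =
        s≤s (≤-trans (≤-reflexive (length-map is-just (skeletonFrom m′ true (unmarkedPrefix w))))
                     (length-prefixSkeleton w linked B≤k))
        ∷ gapPatterns-short true w linked B≤k

module _ {n : ℕ} where

  marked-∈ : ∀ {y : Fin n} {ms} → y ∈ ms → marked ms y ≡ true
  marked-∈ {y} {y ∷ ms} (here refl)  = cong (_∨ marked ms y) (dec-true (y ≟ y) refl)
  marked-∈ {y} {z ∷ ms} (there y∈ms) =
    trans (cong (does (y ≟ z) ∨_) (marked-∈ y∈ms)) (∨-zeroʳ _)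

  marked⇒∈ : ∀ {y : Fin n} ms → marked ms y ≡ true → y ∈ ms
  marked⇒∈ {y} (z ∷ ms) marked-y with y ≟ z
  ... | yes refl = here refl
  ... | no _     = there (marked⇒∈ ms marked-y)

  marked-++⁺ : ∀ ms ns (y : Fin n) → marked ms y ≡ true → marked (ms ++ ns) y ≡ true
  marked-++⁺ ms ns y marked-y = marked-∈ {y = y} {ms = ms ++ ns} (∈-++⁺ˡ (marked⇒∈ ms marked-y))

  marked-∷ʳ-new : ∀ ms (x y : Fin n) →
    marked ms y ≡ false → marked (ms ++ [ x ]) y ≡ true → y ≡ x
  marked-∷ʳ-new ms x y unmarked-y marked-y with ∈-++⁻ ms (marked⇒∈ (ms ++ _) marked-y)
  ... | inj₁ y∈ms       = contradiction (trans (sym (marked-∈ y∈ms)) unmarked-y) λ ()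
  ... | inj₂ (here y≡x) = y≡x

Code : Set
Code = List (ℕ × List Pattern)

module _ {n : ℕ} where

  -- An index outside the pool R, which the encoder never produces, ends decoding.
  decodeFrom : List (Fin n) → Skeleton n → Code → Skeleton n
  decodeFrom R S []             = S
  decodeFrom R S ((j , ps) ∷ c) with pick R j
  ... | nothing       = S
  ... | just (x , R′) = decodeFrom R′ (refine x ps S) c

  decode : Code → Skeleton n
  decode = decodeFrom (allFin n) [ nothing ]

  decodeFrom-∷ : ∀ {R j x R′} S ps c → pick R j ≡ just (x , R′) →
    decodeFrom R S ((j , ps) ∷ c) ≡ decodeFrom R′ (refine x ps S) c
  decodeFrom-∷ S ps c picked rewrite picked = refl

  idle : List (Fin n) → Code
  idle = map (λ _ → (0 , []))

  decodeFrom-idle : ∀ R S → decodeFrom R S (idle R) ≡ S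
  decodeFrom-idle []      S = refl
  decodeFrom-idle (x ∷ R) S =
    trans (cong (λ S′ → decodeFrom R S′ (idle R)) (refine-[] x S)) (decodeFrom-idle R S)

  idle-isLehmerCode : ∀ {bs} → [] ∈ bs → ∀ R → IsLehmerCode bs (length R) (idle R)
  idle-isLehmerCode []∈bs []      = []
  idle-isLehmerCode []∈bs (x ∷ R) = cons (s≤s z≤n) []∈bs (idle-isLehmerCode []∈bs R)

module _ {n : ℕ} where

  data Alternating (x y : Fin n) : Word n → Set where
    []   : Alternating x y []
    cons : ∀ {s} → Alternating y x s → Alternating x y (x ∷ s)

  alternating-^^ : ∀ {x y : Fin n} m {t} → Alternating x y t →
    Alternating x y ((x ∷ y ∷ []) ^^ m ++ t)
  alternating-^^ zero    t-alt = t-alt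
  alternating-^^ (suc m) t-alt = cons (cons (alternating-^^ m t-alt))

  alternating-^^-[] : ∀ {x y : Fin n} m → Alternating x y ((x ∷ y ∷ []) ^^ m)
  alternating-^^-[] {x} {y} m = subst (Alternating x y) (++-identityʳ _) (alternating-^^ m [])

  Alternating⇒stutterFree : ∀ {x y : Fin n} {s} → x ≢ y → Alternating x y s → Linked _≢_ s
  Alternating⇒stutterFree x≢y []                = []
  Alternating⇒stutterFree x≢y (cons [])         = [-]
  Alternating⇒stutterFree x≢y (cons (cons alt)) =
    x≢y ∷ Alternating⇒stutterFree (x≢y ∘ sym) (cons alt)

  Alternate⇒Alternating : ∀ {a b : Fin n} {w} → Alternate a b w →
    Alternating a b (restrict a b w) ⊎ Alternating b a (restrict a b w)
  Alternate⇒Alternating (m , _ , inj₁ r≡)        rewrite r≡ = inj₁ (alternating-^^-[] m)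
  Alternate⇒Alternating (m , _ , inj₂ (inj₁ r≡)) rewrite r≡ = inj₁ (alternating-^^ m (cons []))
  Alternate⇒Alternating (m , _ , inj₂ (inj₂ (inj₁ r≡))) rewrite r≡ = inj₂ (alternating-^^-[] m)
  Alternate⇒Alternating (m , _ , inj₂ (inj₂ (inj₂ r≡))) rewrite r≡ =
    inj₂ (alternating-^^ m (cons []))

  Alternate⇒stutterFree : ∀ {a b : Fin n} {w} → a ≢ b → Alternate a b w →
    Linked _≢_ (restrict a b w)
  Alternate⇒stutterFree {w = w} a≢b alternate =
    Sum.[ Alternating⇒stutterFree a≢b , Alternating⇒stutterFree (a≢b ∘ sym) ]
      (Alternate⇒Alternating {w = w} alternate)

  alternate-restrict : ∀ {a b : Fin n} w₁ w₂ → restrict a b w₁ ≡ restrict a b w₂ →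
    Alternate a b w₁ → Alternate a b w₂
  alternate-restrict {a} {b} w₁ w₂ r≡ (m , 1≤m , forms) =
    m , 1≤m , Sum.map r (Sum.map r (Sum.map r r)) forms
    where
    r : ∀ {t} → restrict a b w₁ ≡ t → restrict a b w₂ ≡ t
    r = trans (sym r≡)

  restrict-square : ∀ (a b : Fin n) u v →
    restrict a b (u ++ a ∷ a ∷ v) ≡ restrict a b u ++ a ∷ a ∷ restrict a b v
  restrict-square a b u v = trans (filter-++ keep? u (a ∷ a ∷ v)) (cong (restrict a b u ++_)
    (trans (filter-accept keep? (inj₁ refl)) (cong (a ∷_) (filter-accept keep? (inj₁ refl)))))
    where keep? = λ (x : Fin n) → (x ≟ a) ⊎-dec (x ≟ b)

  ¬stutterFree-square : ∀ u {a : Fin n} {v} → ¬ Linked _≢_ (u ++ a ∷ a ∷ v)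
  ¬stutterFree-square []      (a≢a ∷ _) = a≢a refl
  ¬stutterFree-square (x ∷ u) linked    = ¬stutterFree-square u (Linked.tail linked)

  stutterFree-if-noSquare : ∀ {w : Word n} → (∀ u a v → w ≢ u ++ a ∷ a ∷ v) → Linked _≢_ w
  stutterFree-if-noSquare {[]}        _        = []
  stutterFree-if-noSquare {x ∷ []}    _        = [-]
  stutterFree-if-noSquare {x ∷ y ∷ w} noSquare =
    (λ { refl → noSquare [] x w refl })
    ∷ stutterFree-if-noSquare (λ u a v w≡ → noSquare (x ∷ u) a v (cong (x ∷_) w≡))

  stutterFree-if-alternating : ∀ {w : Word n} →
    (∀ {a} → a ∈ w → ∃[ b ] (a ≢ b × Alternate a b w)) → Linked _≢_ w
  stutterFree-if-alternating {w} partner = stutterFree-if-noSquare noSquare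
    where
    noSquare : ∀ u a v → w ≢ u ++ a ∷ a ∷ v
    noSquare u a v w≡ with partner (subst (a ∈_) (sym w≡) (∈-++⁺ʳ u (here refl)))
    ... | b , a≢b , alternate = ¬stutterFree-square (restrict a b u)
      (subst (Linked _≢_) (trans (cong (restrict a b) w≡) (restrict-square a b u v))
             (Alternate⇒stutterFree {w = w} a≢b alternate))

module _ {n : ℕ} where

  open import Data.List.Membership.DecPropositional (_≟_ {n}) using (_∈?_)

  NonIsolated : Graph n → Fin n → Set
  NonIsolated G a = ∃[ b ] adj G a b ≡ true

  nonIsolated? : (G : Graph n) → Decidable (NonIsolated G)
  nonIsolated? G a = any? (λ b → adj G a b ≟ᵇ true)

  RepresentsUpToIsolated : Graph n → Word n → Set
  RepresentsUpToIsolated G w =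
    (∀ a → a ∈ w ⇔ NonIsolated G a) ×
    (∀ a b → a ≢ b → a ∈ w → b ∈ w → (Alternate a b w ⇔ adj G a b ≡ true))

  adj⇒≢ : ∀ {G : Graph n} {a b} → IsSimple G → adj G a b ≡ true → a ≢ b
  adj⇒≢ {G} {a} (_ , loopless) ab refl = contradiction (trans (sym ab) (loopless a)) λ ()

  isolated⇒nonAdj : ∀ (G : Graph n) {a} → ¬ NonIsolated G a → ∀ b → adj G a b ≡ false
  isolated⇒nonAdj G {a} isolated b with adj G a b in ab
  ... | true  = ⊥-elim (isolated (b , ab))
  ... | false = refl

  graph-ext : ∀ {G₁ G₂ : Graph n} → (∀ a b → adj G₁ a b ≡ adj G₂ a b) → G₁ ≡ G₂
  graph-ext {G₁} {G₂} same = begin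
    G₁                           ≡⟨ sym (tabulate∘lookup G₁) ⟩
    tabulate (λ a → lookup G₁ a) ≡⟨ tabulate-cong row ⟩
    tabulate (λ a → lookup G₂ a) ≡⟨ tabulate∘lookup G₂ ⟩
    G₂                           ∎
    where
    open ≡-Reasoning
    row : ∀ a → lookup G₁ a ≡ lookup G₂ a
    row a = trans (sym (tabulate∘lookup (lookup G₁ a)))
              (trans (tabulate-cong (same a)) (tabulate∘lookup (lookup G₂ a)))

  representsUpToIsolated-injective : ∀ {G₁ G₂ : Graph n} {w} → IsSimple G₁ → IsSimple G₂ →
    RepresentsUpToIsolated G₁ w → RepresentsUpToIsolated G₂ w → G₁ ≡ G₂
  representsUpToIsolated-injective {G₁} {G₂} {w} simple₁ simple₂
                                   (letters₁ , alt₁) (letters₂ , alt₂) = graph-ext same-adj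
    where
    absent⇒nonAdj : ∀ G {a} → (∀ a → a ∈ w ⇔ NonIsolated G a) → a ∉ w →
      ∀ b → adj G a b ≡ false
    absent⇒nonAdj G {a} letters a∉w = isolated⇒nonAdj G (a∉w ∘ Equivalence.from (letters a))
    same-adj : ∀ a b → adj G₁ a b ≡ adj G₂ a b
    same-adj a b with a ≟ b | a ∈? w | b ∈? w
    ... | yes refl | _       | _       = trans (proj₂ simple₁ a) (sym (proj₂ simple₂ a))
    ... | no a≢b   | yes a∈w | yes b∈w =
      ⇔→≡ (⇔-trans (⇔-sym (alt₁ a b a≢b a∈w b∈w)) (alt₂ a b a≢b a∈w b∈w))
    ... | no _     | no a∉w  | _       =
      trans (absent⇒nonAdj G₁ letters₁ a∉w b) (sym (absent⇒nonAdj G₂ letters₂ a∉w b))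
    ... | no _     | yes _   | no b∉w  =
      trans (proj₁ simple₁ a b) (trans (absent⇒nonAdj G₁ letters₁ b∉w a)
        (sym (trans (proj₁ simple₂ a b) (absent⇒nonAdj G₂ letters₂ b∉w a))))

filter-filter-⊆ : {A : Set} {P Q : A → Set} (P? : Decidable P) (Q? : Decidable Q) →
  (∀ {x} → Q x → P x) → ∀ xs → filter Q? (filter P? xs) ≡ filter Q? xs
filter-filter-⊆ P? Q? Q⇒P []       = refl
filter-filter-⊆ P? Q? Q⇒P (x ∷ xs) with P? x
... | no ¬Px = trans (filter-filter-⊆ P? Q? Q⇒P xs) (sym (filter-reject Q? (¬Px ∘ Q⇒P)))
... | yes _ with does (Q? x)
...   | true  = cong (x ∷_) (filter-filter-⊆ P? Q? Q⇒P xs)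
...   | false = filter-filter-⊆ P? Q? Q⇒P xs

module _ {n : ℕ} {G : Graph n} where

  removeIsolated : Word n → Word n
  removeIsolated = filter (nonIsolated? G)

  removeIsolated-represents : ∀ {w} → Represents G w → RepresentsUpToIsolated G (removeIsolated w)
  removeIsolated-represents {w} (all-letters , alternation) = letters , alternation′
    where
    letters : ∀ a → a ∈ removeIsolated w ⇔ NonIsolated G a
    letters a = mk⇔ (proj₂ ∘ ∈-filter⁻ (nonIsolated? G) {xs = w})
                    (∈-filter⁺ (nonIsolated? G) (all-letters a))
    alternation′ : ∀ a b → a ≢ b → a ∈ removeIsolated w → b ∈ removeIsolated w →
      (Alternate a b (removeIsolated w) ⇔ adj G a b ≡ true)
    alternation′ a b a≢b a∈ b∈ =
      ⇔-trans (mk⇔ (alternate-restrict (removeIsolated w) w same-restriction)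
                   (alternate-restrict w (removeIsolated w) (sym same-restriction)))
              (alternation a b a≢b)
      where
      same-restriction : restrict a b (removeIsolated w) ≡ restrict a b w
      same-restriction = filter-filter-⊆ (nonIsolated? G) (λ x → (x ≟ a) ⊎-dec (x ≟ b))
        (λ { (inj₁ refl) → Equivalence.to (letters a) a∈
           ; (inj₂ refl) → Equivalence.to (letters b) b∈ }) w

  representsUpToIsolated-stutterFree : ∀ {w} → IsSimple G → RepresentsUpToIsolated G w →
    Linked _≢_ w
  representsUpToIsolated-stutterFree {w} simple (letters , alternation) =
    stutterFree-if-alternating partner
    where
    partner : ∀ {a} → a ∈ w → ∃[ b ] (a ≢ b × Alternate a b w)
    partner {a} a∈w with Equivalence.to (letters a) a∈w
    ... | b , ab = b , adj⇒≢ {G = G} simple ab ,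
      Equivalence.from (alternation a b (adj⇒≢ {G = G} simple ab) a∈w b∈w) ab
      where
      b∈w : b ∈ w
      b∈w = Equivalence.from (letters b) (a , trans (proj₁ simple b a) ab)

-- At most k + 1 gaps, each refined by a pattern of length at most 2k + 1.
alphabet : ℕ → List (List Pattern)
alphabet k = listsUpTo (suc k) (listsUpTo (suc (k + k)) (true ∷ false ∷ []))

∈-alphabet : ∀ k {ps} → length ps ≤ suc k → All (λ p → length p ≤ suc (k + k)) ps →
  ps ∈ alphabet k
∈-alphabet k ps≤ short =
  ∈-listsUpTo (suc k) ps≤ (λ p∈ps → ∈-listsUpTo (suc (k + k)) (All.lookup short p∈ps) bool∈)
  where
  bool∈ : ∀ {p : Pattern} {b} → b ∈ p → b ∈ true ∷ false ∷ []
  bool∈ {b = true}  _ = here refl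
  bool∈ {b = false} _ = there (here refl)

take-length-++ : {A : Set} (xs ys : List A) → take (length xs) (xs ++ ys) ≡ xs
take-length-++ []       ys = refl
take-length-++ (x ∷ xs) ys = cong (x ∷_) (take-length-++ xs ys)

module Encoding {n : ℕ} (k : ℕ) (w : Word n) (σ : List (Fin n)) (unique : Unique σ) (w⊆σ : w ⊆ σ)
  (stutterFree : Linked _≢_ w) (local : ∀ i → i ≤ length σ → blocks (marked (take i σ)) w ≤ k)
  where

  local-prefix : ∀ pre rest → σ ≡ pre ++ rest → blocks (marked pre) w ≤ k
  local-prefix pre rest σ≡ =
    subst (λ ms → blocks (marked ms) w ≤ k) take-pre (local (length pre) pre≤σ)
    where
    take-pre : take (length pre) σ ≡ pre
    take-pre = trans (cong (take (length pre)) σ≡) (take-length-++ pre rest)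
    pre≤σ : length pre ≤ length σ
    pre≤σ = subst (λ s → length pre ≤ length s) (sym σ≡)
                  (≤-trans (m≤m+n _ _) (≤-reflexive (sym (length-++ pre))))

  -- pre is the part of σ marked so far and R the pool from which the decoder picks letters.
  encodeFrom : ∀ pre rest → σ ≡ pre ++ rest → Unique rest → ∀ R → rest ⊆ R →
    ∃[ c ] (IsLehmerCode (alphabet k) (length R) c ×
            decodeFrom R (skeleton (marked pre) w) c ≡ nothing ∷ map just w)
  encodeFrom pre [] σ≡ _ R _ =
    idle R , idle-isLehmerCode (here refl) R ,
    trans (decodeFrom-idle R _)
          (cong (nothing ∷_) (skeletonFrom-allMarked true (marked-∈ ∘ σ⊆pre ∘ w⊆σ)))
    where
    σ⊆pre : σ ⊆ pre
    σ⊆pre = subst (_ ∈_) (trans σ≡ (++-identityʳ pre))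
  encodeFrom pre (x ∷ rest) σ≡ (x∉rest ∷ unique-rest) R x∷rest⊆R =
    (index , ps) ∷ c , code , decodes
    where
    open Picking (picking (x∷rest⊆R (here refl)))
    open Refinement (marked pre) (marked (pre ++ [ x ])) x
                    (marked-++⁺ pre [ x ]) (marked-∷ʳ-new pre x)
    σ≡′ : σ ≡ (pre ++ [ x ]) ++ rest
    σ≡′ = trans σ≡ (sym (++-assoc pre [ x ] rest))
    rest⊆remainder : rest ⊆ remainder
    rest⊆remainder y∈rest =
      ∈-remainder (x∷rest⊆R (there y∈rest)) (λ { refl → All.lookup x∉rest y∈rest refl })
    ps = refinementPatterns w
    next = encodeFrom (pre ++ [ x ]) rest σ≡′ unique-rest remainder rest⊆remainder
    c = proj₁ next
    ps∈alphabet : ps ∈ alphabet k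
    ps∈alphabet = ∈-alphabet k
      (≤-trans (length-refinementPatterns w) (s≤s (local-prefix pre (x ∷ rest) σ≡)))
      (refinementPatterns-short w stutterFree (local-prefix (pre ++ [ x ]) rest σ≡′))
    code : IsLehmerCode (alphabet k) (length R) ((index , ps) ∷ c)
    code = subst (λ r → IsLehmerCode (alphabet k) r ((index , ps) ∷ c)) (sym length-remainder)
      (cons (subst (index <_) length-remainder index<length) ps∈alphabet (proj₁ (proj₂ next)))
    decodes : decodeFrom R (skeleton (marked pre) w) ((index , ps) ∷ c) ≡ nothing ∷ map just w
    decodes = begin
      decodeFrom R (skeleton (marked pre) w) ((index , ps) ∷ c)
        ≡⟨ decodeFrom-∷ {R = R} {j = index} (skeleton (marked pre) w) ps c pick-index ⟩
      decodeFrom remainder (refine x ps (skeleton (marked pre) w)) c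
        ≡⟨ cong (λ S → decodeFrom remainder S c) (sym (skeleton-refine w)) ⟩
      decodeFrom remainder (skeleton (marked (pre ++ [ x ])) w) c
        ≡⟨ proj₂ (proj₂ next) ⟩
      nothing ∷ map just w ∎
      where open ≡-Reasoning

  encode : ∃[ c ] (c ∈ lehmerCodes (alphabet k) n × decode c ≡ nothing ∷ map just w)
  encode with encodeFrom [] σ refl unique (allFin n) (λ {y} _ → ∈-allFin y)
  ... | c , code , decodes =
    c , subst (λ r → c ∈ lehmerCodes (alphabet k) r) (length-tabulate {n = n} id) (∈-lehmerCodes code) ,
    trans (cong (λ S → decodeFrom (allFin n) (nothing ∷ S) c) (sym (skeletonFrom-noneMarked w)))
          decodes

module _ {n : ℕ} where

  record EncodedBy (G : Graph n) (c : Code) : Set where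
    constructor encodedBy
    field
      simple     : IsSimple G
      word       : Word n
      represents : RepresentsUpToIsolated G word
      decodes    : decode c ≡ nothing ∷ map just word

  encodedBy-injective : ∀ {G₁ G₂ c} → EncodedBy G₁ c → EncodedBy G₂ c → G₁ ≡ G₂
  encodedBy-injective (encodedBy simple₁ w₁ represents₁ decodes₁)
                      (encodedBy simple₂ w₂ represents₂ decodes₂)
    with map-injective just-injective (∷-injectiveʳ (trans (sym decodes₁) decodes₂))
  ... | refl = representsUpToIsolated-injective simple₁ simple₂ represents₁ represents₂

  encode-graph : ∀ k {G} → InL k n G → ∃[ c ] (c ∈ lehmerCodes (alphabet k) n × EncodedBy G c)
  encode-graph k {G} (simple , w , represents , σ , (unique , σ⇔w) , local) =
    c , c∈codes , encodedBy simple reduced reduced-represents decodes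
    where
    reduced : Word n
    reduced = removeIsolated {G = G} w
    reduced-represents : RepresentsUpToIsolated G reduced
    reduced-represents = removeIsolated-represents {G = G} represents
    reduced⊆σ : reduced ⊆ σ
    reduced⊆σ = Equivalence.from (σ⇔w _) ∘ proj₁ ∘ ∈-filter⁻ (nonIsolated? G) {xs = w}
    reduced-local : ∀ i → i ≤ length σ → blocks (marked (take i σ)) reduced ≤ k
    reduced-local i i≤ =
      ≤-trans (blocksFrom-filter (marked (take i σ)) (nonIsolated? G) false w) (local i i≤)
    open Encoding k reduced σ unique reduced⊆σ
      (representsUpToIsolated-stutterFree {G = G} simple reduced-represents) reduced-local
    c = proj₁ encode
    c∈codes = proj₁ (proj₂ encode)
    decodes = proj₂ (proj₂ encode)

mainTheorem8 : (k : ℕ) → ∃[ C ] ((n : ℕ) → (gs : List (Graph n)) →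
                 Unique gs → All (InL k n) gs → length gs ≤ (n !) * C ^ n)
mainTheorem8 k = length (alphabet k) , λ n gs unique inL → begin
  length gs
    ≤⟨ length-≤-injectiveRel EncodedBy unique (encode-graph k ∘ All.lookup inL) encodedBy-injective ⟩
  length (lehmerCodes (alphabet k) n)
    ≡⟨ length-lehmerCodes (alphabet k) n ⟩
  n ! * length (alphabet k) ^ n ∎
  where open ≤-Reasoning
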